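{- Let $\ell\ge 3$ and $n\ge 1$ be integers, and let $n_1,\dots,n_\ell$ be positive integers with $n_i\le n$ for all $i\in\{1,\dots,\ell\}$ and $n_1+\cdots+n_\ell\ge 2n+1$. Then the complete multipartite graph $K_{n_1,n_2,\dots,n_\ell}$ contains a cycle of length $2n+1$.
   Context: $K_{n_1,\dots,n_\ell}$ denotes the complete $\ell$-partite graph with parts of sizes $n_1,\dots,n_\ell$. -}

module Defs where

open import Data.Nat using (ℕ; zero; suc; _+_; _*_; _≤_; _<_)
open import Data.Fin using (Fin; toℕ; fromℕ<)
import Data.Fin
open import Data.Fin.Properties using ()
open import Data.Nat.DivMod using (_%_; m%n<n)
open import Data.Product using (Σ; _,_; proj₁; _×_; ∃)
open import Relation.Binary.PropositionalEquality using (_≡_; _≢_)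
open import Function.Definitions using (Injective)
open import Level using (0ℓ)

Σᶠ : (ℓ : ℕ) → (Fin ℓ → ℕ) → ℕ
Σᶠ zero    f = 0
Σᶠ (suc ℓ) f = f Fin.zero + Σᶠ ℓ (λ i → f (Fin.suc i))

record Graph : Set₁ where
  field
    V   : Set
    Adj : V → V → Set

K : (ℓ : ℕ) → (Fin ℓ → ℕ) → Graph
K ℓ n = record
  { V   = Σ (Fin ℓ) (λ i → Fin (n i))
  ; Adj = λ u v → proj₁ u ≢ proj₁ v
  }

sucMod : (k : ℕ) → Fin k → Fin k
sucMod (suc k) i = fromℕ< (m%n<n (suc (toℕ i)) (suc k))

HasCycle : Graph → ℕ → Set
HasCycle G k = 3 ≤ k × Σ (Fin k → Graph.V G) (λ v →
  Injective _≡_ _≡_ v × ((i : Fin k) → Graph.Adj G (v i) (v (sucMod k i))))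

-- Lay the vertices out on a line, part after part, so every vertex gets a
-- position in [0, N) with N = n_1 + ... + n_ℓ.  Each part occupies an interval
-- of at most n consecutive positions, hence two vertices whose positions
-- differ by at least n lie in different parts and are adjacent.
--
-- So it suffices to list 2n+1 distinct positions in [0, 2n] in a cyclic order
-- in which consecutive entries differ by at least n.  The zigzag order
--   0, n+1, 1, n+2, 2, ..., 2n, n
-- does this: steps are +(n+1) or -n, and the closing step from n to 0 is -n.

module Submission where

open import Defs
open import Data.Nat using (ℕ; zero; suc; _+_; _*_; _∸_; _%_; _≤_; _<_; _<?_; s≤s)
open import Data.Fin using (Fin)
import Data.Fin as F
open import Data.Fin.Properties using (toℕ-fromℕ<; toℕ-injective; toℕ<n)
open import Data.Nat.Properties
open import Data.Nat.DivMod using (m<n⇒m%n≡m; n%n≡0)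
open import Data.Product using (Σ; _,_; proj₁; proj₂; _×_)
open import Data.Sum using (_⊎_; inj₁; inj₂)
open import Relation.Nullary using (yes; no)
open import Relation.Binary.PropositionalEquality
open import Data.Empty using (⊥-elim)

Vertex : {ℓ : ℕ} → (Fin ℓ → ℕ) → Set
Vertex {ℓ} ns = Σ (Fin ℓ) (λ i → Fin (ns i))

offset : {ℓ : ℕ} → (Fin ℓ → ℕ) → Fin ℓ → ℕ
offset ns F.zero    = 0
offset ns (F.suc i) = ns F.zero + offset (λ j → ns (F.suc j)) i

position : {ℓ : ℕ} → (ns : Fin ℓ → ℕ) → Vertex ns → ℕ
position ns (i , x) = offset ns i + F.toℕ x

vertexAt : (ℓ : ℕ) (ns : Fin ℓ → ℕ) (p : ℕ) → p < Σᶠ ℓ ns →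
           Σ (Vertex ns) (λ v → position ns v ≡ p)
vertexAt (suc ℓ) ns p p<N with p <? ns F.zero
... | yes p<n₀ = (F.zero , F.fromℕ< p<n₀) , toℕ-fromℕ< p<n₀
... | no  p≮n₀ = (F.suc i , x) , position-eq
  where
  tail : Fin ℓ → ℕ
  tail j = ns (F.suc j)
  r : ℕ
  r = p ∸ ns F.zero
  n₀+r≡p : ns F.zero + r ≡ p
  n₀+r≡p = m+[n∸m]≡n (≮⇒≥ p≮n₀)
  r<rest : r < Σᶠ ℓ tail
  r<rest = +-cancelˡ-< (ns F.zero) r _ (subst (_< Σᶠ (suc ℓ) ns) (sym n₀+r≡p) p<N)
  rec : Σ (Vertex tail) (λ v → position tail v ≡ r)
  rec = vertexAt ℓ tail r r<rest
  i : Fin ℓ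
  i = proj₁ (proj₁ rec)
  x : Fin (tail i)
  x = proj₂ (proj₁ rec)
  position-eq : ns F.zero + offset tail i + F.toℕ x ≡ p
  position-eq = begin
    ns F.zero + offset tail i + F.toℕ x   ≡⟨ +-assoc (ns F.zero) _ _ ⟩
    ns F.zero + (offset tail i + F.toℕ x) ≡⟨ cong (ns F.zero +_) (proj₂ rec) ⟩
    ns F.zero + r                         ≡⟨ n₀+r≡p ⟩
    p                                     ∎
    where open ≡-Reasoning

same-part⇒close : {ℓ n : ℕ} (ns : Fin ℓ → ℕ) → ((i : Fin ℓ) → ns i ≤ n) →
  (i : Fin ℓ) (x y : Fin (ns i)) (d : ℕ) →
  position ns (i , x) ≡ position ns (i , y) + d → d < n
same-part⇒close ns bd i x y d e = begin-strict
  d                 ≤⟨ m≤n+m d (F.toℕ y) ⟩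
  F.toℕ y + d       ≡⟨ sym x≡y+d ⟩
  F.toℕ x           <⟨ toℕ<n x ⟩
  ns i              ≤⟨ bd i ⟩
  _                 ∎
  where
  open ≤-Reasoning
  x≡y+d : F.toℕ x ≡ F.toℕ y + d
  x≡y+d = +-cancelˡ-≡ (offset ns i) _ _ (trans e (+-assoc (offset ns i) (F.toℕ y) d))

Spread : ℕ → ℕ → ℕ → Set
Spread n a b = Σ ℕ (λ d → n ≤ d × (a ≡ b + d ⊎ b ≡ a + d))

spread⇒different-parts : {ℓ n : ℕ} (ns : Fin ℓ → ℕ) → ((i : Fin ℓ) → ns i ≤ n) →
  (u w : Vertex ns) → Spread n (position ns u) (position ns w) → proj₁ u ≢ proj₁ w
spread⇒different-parts ns bd (i , x) (.i , y) (d , n≤d , inj₁ e) refl =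
  <⇒≱ (same-part⇒close ns bd i x y d e) n≤d
spread⇒different-parts ns bd (i , x) (.i , y) (d , n≤d , inj₂ e) refl =
  <⇒≱ (same-part⇒close ns bd i y x d e) n≤d

sucMod-cases : (k : ℕ) (i : Fin k) →
  (suc (F.toℕ i) < k × F.toℕ (sucMod k i) ≡ suc (F.toℕ i)) ⊎
  (suc (F.toℕ i) ≡ k × F.toℕ (sucMod k i) ≡ 0)
sucMod-cases (suc k) i with m≤n⇒m<n∨m≡n (toℕ<n i)
... | inj₁ lt = inj₁ (lt , trans (toℕ-fromℕ< _) (m<n⇒m%n≡m lt))
... | inj₂ eq = inj₂ (eq , trans (toℕ-fromℕ< _) (trans (cong (_% suc k) eq) (n%n≡0 (suc k))))

spread-positions⇒cycle : {ℓ n : ℕ} (ns : Fin ℓ → ℕ) → ((i : Fin ℓ) → ns i ≤ n) →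
  (k : ℕ) → 3 ≤ k → (p : ℕ → ℕ) →
  (∀ j → j < k → p j < Σᶠ ℓ ns) →
  (∀ j j' → j < k → j' < k → p j ≡ p j' → j ≡ j') →
  (∀ j → suc j < k → Spread n (p j) (p (suc j))) →
  (∀ j → suc j ≡ k → Spread n (p j) (p 0)) →
  HasCycle (K ℓ ns) k
spread-positions⇒cycle {ℓ} ns bd k 3≤k p occupied distinct step wrap =
  3≤k , v , v-injective , v-adjacent
  where
  located : (i : Fin k) → Σ (Vertex ns) (λ u → position ns u ≡ p (F.toℕ i))
  located i = vertexAt ℓ ns (p (F.toℕ i)) (occupied (F.toℕ i) (toℕ<n i))
  v : Fin k → Vertex ns
  v i = proj₁ (located i)
  pos-v : (i : Fin k) → position ns (v i) ≡ p (F.toℕ i)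
  pos-v i = proj₂ (located i)
  v-injective : ∀ {i j} → v i ≡ v j → i ≡ j
  v-injective {i} {j} e = toℕ-injective (distinct _ _ (toℕ<n i) (toℕ<n j)
    (trans (sym (pos-v i)) (trans (cong (position ns) e) (pos-v j))))
  spread-to-successor : (i : Fin k) → Spread _ (p (F.toℕ i)) (p (F.toℕ (sucMod k i)))
  spread-to-successor i with sucMod-cases k i
  ... | inj₁ (lt , e) rewrite e = step (F.toℕ i) lt
  ... | inj₂ (eq , e) rewrite e = wrap (F.toℕ i) eq
  v-adjacent : (i : Fin k) → proj₁ (v i) ≢ proj₁ (v (sucMod k i))
  v-adjacent i = spread⇒different-parts ns bd (v i) (v (sucMod k i))
    (subst₂ (Spread _) (sym (pos-v i)) (sym (pos-v (sucMod k i))) (spread-to-successor i))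

double-cancel-≤ : ∀ k m → k + k ≤ m + m → k ≤ m
double-cancel-≤ k m h = ≮⇒≥ (λ m<k → <⇒≱ (+-mono-< m<k m<k) h)

double-cancel-< : ∀ k m → k + k < m + m → k < m
double-cancel-< k m h = ≰⇒> (λ m≤k → <⇒≱ h (+-mono-≤ m≤k m≤k))

module Zigzag (n : ℕ) where

  zigzag : ℕ → ℕ
  zigzag zero          = zero
  zigzag (suc zero)    = suc n
  zigzag (suc (suc j)) = suc (zigzag j)

  even-or-odd : ∀ j → Σ ℕ λ k → j ≡ k + k ⊎ j ≡ suc (k + k)
  even-or-odd zero = 0 , inj₁ refl
  even-or-odd (suc j) with even-or-odd j
  ... | k , inj₁ e = k , inj₂ (cong suc e)
  ... | k , inj₂ e = suc k , inj₁ (trans (cong suc e) (cong suc (sym (+-suc k k))))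

  zigzag-even : ∀ k → zigzag (k + k) ≡ k
  zigzag-even zero = refl
  zigzag-even (suc k) rewrite +-suc k k = cong suc (zigzag-even k)

  zigzag-odd : ∀ k → zigzag (suc (k + k)) ≡ suc (n + k)
  zigzag-odd zero = cong suc (sym (+-identityʳ n))
  zigzag-odd (suc k) rewrite +-suc k k | +-suc n k = cong suc (zigzag-odd k)

  zigzag-even-low : ∀ k → k + k < suc (n + n) → zigzag (k + k) ≤ n
  zigzag-even-low k lt = subst (_≤ n) (sym (zigzag-even k)) (double-cancel-≤ k n (≤-pred lt))

  zigzag-odd-high : ∀ k → suc (k + k) < suc (n + n) →
                    n < zigzag (suc (k + k)) × zigzag (suc (k + k)) < suc (n + n)
  zigzag-odd-high k lt rewrite zigzag-odd k =
    s≤s (m≤m+n n k) , s≤s (+-monoʳ-< n (double-cancel-< k n (≤-pred lt)))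

  zigzag-bound : ∀ j → j < suc (n + n) → zigzag j < suc (n + n)
  zigzag-bound j lt with even-or-odd j
  ... | k , inj₁ refl = s≤s (≤-trans (zigzag-even-low k lt) (m≤m+n n n))
  ... | k , inj₂ refl = proj₂ (zigzag-odd-high k lt)

  zigzag-injective : ∀ j j' → j < suc (n + n) → j' < suc (n + n) →
                     zigzag j ≡ zigzag j' → j ≡ j'
  zigzag-injective j j' lt lt' e with even-or-odd j | even-or-odd j'
  ... | k , inj₁ refl | k' , inj₁ refl =
    cong (λ t → t + t) (trans (sym (zigzag-even k)) (trans e (zigzag-even k')))
  ... | k , inj₂ refl | k' , inj₂ refl =
    cong (λ t → suc (t + t)) (+-cancelˡ-≡ n _ _
      (suc-injective (trans (sym (zigzag-odd k)) (trans e (zigzag-odd k')))))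
  ... | k , inj₁ refl | k' , inj₂ refl = ⊥-elim (<⇒≱ (proj₁ (zigzag-odd-high k' lt'))
    (subst (_≤ n) e (zigzag-even-low k lt)))
  ... | k , inj₂ refl | k' , inj₁ refl = ⊥-elim (<⇒≱ (proj₁ (zigzag-odd-high k lt))
    (subst (_≤ n) (sym e) (zigzag-even-low k' lt')))

  zigzag-step : ∀ j → Spread n (zigzag j) (zigzag (suc j))
  zigzag-step zero          = suc n , n≤1+n n , inj₂ refl
  zigzag-step (suc zero)    = n , ≤-refl , inj₁ refl
  zigzag-step (suc (suc j)) with zigzag-step j
  ... | d , n≤d , inj₁ e = d , n≤d , inj₁ (cong suc e)
  ... | d , n≤d , inj₂ e = d , n≤d , inj₂ (cong suc e)

  zigzag-wrap : ∀ j → suc j ≡ suc (n + n) → Spread n (zigzag j) (zigzag 0)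
  zigzag-wrap j eq rewrite suc-injective eq = n , ≤-refl , inj₁ (zigzag-even n)

2n+1≡suc[n+n] : (n : ℕ) → 2 * n + 1 ≡ suc (n + n)
2n+1≡suc[n+n] n = trans (+-comm (2 * n) 1) (cong (λ t → suc (n + t)) (+-identityʳ n))

lemma1p12 : (ℓ n : ℕ) → 3 ≤ ℓ → 1 ≤ n → (ns : Fin ℓ → ℕ) →
    ((i : Fin ℓ) → 1 ≤ ns i) → ((i : Fin ℓ) → ns i ≤ n) →
    2 * n + 1 ≤ Σᶠ ℓ ns →
    HasCycle (K ℓ ns) (2 * n + 1)
lemma1p12 ℓ n _ 1≤n ns _ bd big =
  subst (HasCycle (K ℓ ns)) (sym (2n+1≡suc[n+n] n))
    (spread-positions⇒cycle ns bd (suc (n + n)) 3≤2n+1 zigzag occupied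
      zigzag-injective (λ j _ → zigzag-step j) zigzag-wrap)
  where
  open Zigzag n
  3≤2n+1 : 3 ≤ suc (n + n)
  3≤2n+1 = s≤s (+-mono-≤ 1≤n 1≤n)
  occupied : ∀ j → j < suc (n + n) → zigzag j < Σᶠ ℓ ns
  occupied j lt = <-≤-trans (zigzag-bound j lt) (subst (_≤ Σᶠ ℓ ns) (2n+1≡suc[n+n] n) big)
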